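{- Let $X$ be a connected simplicial complex, let $\Gamma$ be a finite group acting on a set $\Sigma$ via a homomorphism $\phi:\Gamma\to \mathrm{Sym}(\Sigma)$, let $f\in C^1(X,\Gamma)$, and let $U$ be the unique games instance induced by $f$ over $\Sigma$. Then: (1) If $f\in B^1(X,\Gamma)$ then $U$ is strongly satisfiable. (2) If $U$ is strongly satisfiable then $\phi(f)\in B^1(X,\phi(\Gamma))$, where $\phi(f)(u,v)=\phi(f(u,v))$. Moreover, if $\phi$ is faithful (injective), then $f\in B^1(X,\Gamma)$.
   Context: $C^0(X,\Gamma)$ is the set of maps $X(0)\to\Gamma$, $C^1(X,\Gamma)$ the set of maps $f$ on ordered edges with $f(u,v)=f(v,u)^{ -1}$, $\delta_0 g(u,v)=g(u)g(v)^{ -1}$, and $B^1(X,\Gamma)=\{\delta_0 g: g\in C^0(X,\Gamma)\}$. The unique games instance induced by $f$ has variables $X(0)$ and alphabet $\Sigma$; an assignment $h:X(0)\to\Sigma$ satisfies it if for every ordered edge $(u,v)$, $f(u,v).h(v)=h(u)$ (action of $\Gamma$ on $\Sigma$). The instance is strongly satisfiable if there are satisfying assignments $\{h_\sigma\}_{\sigma\in\Sigma}$ such that for every vertex $v$, $\{h_\sigma(v):\sigma\in\Sigma\}=\Sigma$. -}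

module Defs where

open import Level using (0ℓ)
open import Data.Nat using (ℕ)
open import Data.Fin using (Fin)
open import Data.List using (List; []; _∷_)
open import Data.List.Membership.Propositional using (_∈_)
open import Data.Product using (Σ; ∃; _×_; _,_)
open import Relation.Binary.PropositionalEquality using (_≡_; _≢_)
open import Relation.Binary.Construct.Closure.ReflexiveTransitive using (Star)
open import Algebra.Bundles using (Group)

-- Abstract simplicial complex on a vertex type V: faces are finite
-- vertex lists (read as sets); every vertex is a face and faces are
-- closed under taking nonempty subsets.
record SimplicialComplex : Set₁ where
  field
    V      : Set
    IsFace : List V → Set
    vertex-face : ∀ v → IsFace (v ∷ [])
    down-closed : ∀ {s t} → IsFace s → (∀ {x} → x ∈ t → x ∈ s) → IsFace t

  Edge : V → V → Set
  Edge u v = (u ≢ v) × IsFace (u ∷ v ∷ [])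

Connected : SimplicialComplex → Set
Connected X = SimplicialComplex.V X × (∀ u v → Star Edge u v)
  where open SimplicialComplex X

IsFiniteGroup : Group 0ℓ 0ℓ → Set
IsFiniteGroup G = Σ ℕ λ n → Σ (Fin n → Carrier) λ e → ∀ x → ∃ λ i → e i ≈ x
  where open Group G

-- A homomorphism φ : Γ → Sym(Σ), i.e. a (left) action of Γ on the set S.
-- φ(γ) is the map  act γ : S → S.
record Action (G : Group 0ℓ 0ℓ) (S : Set) : Set where
  open Group G
  field
    act      : Carrier → S → S
    act-cong : ∀ {x y} → x ≈ y → ∀ s → act x s ≡ act y s
    act-ε    : ∀ s → act ε s ≡ s
    act-∙    : ∀ x y s → act (x ∙ y) s ≡ act x (act y s)

Faithful : {G : Group 0ℓ 0ℓ} {S : Set} → Action G S → Set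
Faithful {G} A = ∀ x y → (∀ s → act x s ≡ act y s) → x ≈ y
  where open Group G
        open Action A

module _ (X : SimplicialComplex) (G : Group 0ℓ 0ℓ) where
  open SimplicialComplex X
  open Group G renaming (Carrier to Γ)

  IsCochain1 : (V → V → Γ) → Set
  IsCochain1 f = ∀ u v → Edge u v → f u v ≈ f v u ⁻¹

  δ₀ : (V → Γ) → V → V → Γ
  δ₀ g u v = g u ∙ g v ⁻¹

  IsCoboundary : (V → V → Γ) → Set
  IsCoboundary f = Σ (V → Γ) λ g → ∀ u v → Edge u v → f u v ≈ δ₀ g u v

  module _ {S : Set} (A : Action G S) where
    open Action A

    Satisfies : (V → V → Γ) → (V → S) → Set
    Satisfies f h = ∀ u v → Edge u v → act (f u v) (h v) ≡ h u

    StronglySatisfiable : (V → V → Γ) → Set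
    StronglySatisfiable f =
      Σ (S → V → S) λ h →
        (∀ σ → Satisfies f (h σ)) × (∀ v τ → ∃ λ σ → h σ v ≡ τ)

    -- φ(f) ∈ B^1(X, φ(Γ)): there is g : V → φ(Γ) (written as g = φ ∘ γ
    -- with γ : V → Γ) such that φ(f(u,v)) = g(u) g(v)⁻¹ in Sym(S);
    -- equality of permutations is pointwise, and g(u) g(v)⁻¹ = φ(γ u ∙ γ v ⁻¹).
    ImageIsCoboundary : (V → V → Γ) → Set
    ImageIsCoboundary f =
      Σ (V → Γ) λ γ → ∀ u v → Edge u v →
        ∀ s → act (f u v) s ≡ act (γ u ∙ γ v ⁻¹) s

-- A coboundary δ₀ g relabels the trivial instance: h_σ(v) = g(v).σ satisfies
-- it, and at each vertex σ ↦ g(v).σ is a bijection.  Conversely, on a connected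
-- complex a satisfying assignment is determined by its value at a base vertex v₀,
-- h(v) = γ(v).h(v₀), where γ(v) is the product of f along a path from v to v₀.
-- If the assignments h_σ take every value at v₀, then φ(f(u,v)) and
-- φ(γ(u) γ(v)⁻¹) agree on every point of Σ, i.e. φ(f) = δ₀ (φ ∘ γ); faithfulness
-- lifts this back to Γ.
module Submission where

open import Defs
open import Level using (0ℓ)
open import Data.Product using (_×_; _,_)
open import Algebra.Bundles using (Group)
import Algebra.Properties.Group as GroupProperties
open import Relation.Binary.PropositionalEquality
  using (_≡_; sym; trans; cong; module ≡-Reasoning)
open import Relation.Binary.Construct.Closure.ReflexiveTransitive using (Star; ε; _◅_)

module _ {G : Group 0ℓ 0ℓ} {S : Set} (A : Action G S) where
  open Group G using (_⁻¹; inverseʳ)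
  open Action A

  act-inverseʳ : ∀ g s → act g (act (g ⁻¹) s) ≡ s
  act-inverseʳ g s = trans (sym (act-∙ g (g ⁻¹) s)) (trans (act-cong (inverseʳ g) s) (act-ε s))

module _ (X : SimplicialComplex) (G : Group 0ℓ 0ℓ) {S : Set} (A : Action G S) where
  open SimplicialComplex X
  open Group G using (_∙_; _⁻¹; ∙-congʳ) renaming (Carrier to Γ; ε to 1ᴳ; trans to ≈-trans)
  open GroupProperties G using (//-rightDividesˡ)
  open Action A
  open ≡-Reasoning

  coboundary⇒stronglySatisfiable : ∀ f → IsCoboundary X G f → StronglySatisfiable X G A f
  coboundary⇒stronglySatisfiable f (g , f≈δ₀g) =
    (λ σ v → act (g v) σ) , satisfies , (λ v τ → act (g v ⁻¹) τ , act-inverseʳ A (g v) τ)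
    where
    satisfies : ∀ σ → Satisfies X G A f (λ v → act (g v) σ)
    satisfies σ u v uv = begin
      act (f u v) (act (g v) σ)  ≡⟨ act-∙ (f u v) (g v) σ ⟨
      act (f u v ∙ g v) σ        ≡⟨ act-cong (≈-trans (∙-congʳ (f≈δ₀g u v uv)) (//-rightDividesˡ (g v) (g u))) σ ⟩
      act (g u) σ                ∎

  module _ (f : V → V → Γ) where

    holonomy : ∀ {u v} → Star Edge u v → Γ
    holonomy ε = 1ᴳ
    holonomy (_◅_ {u} {w} _ p) = f u w ∙ holonomy p

    satisfies⇒act-holonomy : ∀ {h} → Satisfies X G A f h →
                             ∀ {u v} (p : Star Edge u v) → act (holonomy p) (h v) ≡ h u
    satisfies⇒act-holonomy sat ε = act-ε _
    satisfies⇒act-holonomy {h} sat (_◅_ {u} {w} {v} uw p) = begin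
      act (f u w ∙ holonomy p) (h v)        ≡⟨ act-∙ (f u w) (holonomy p) (h v) ⟩
      act (f u w) (act (holonomy p) (h v))  ≡⟨ cong (act (f u w)) (satisfies⇒act-holonomy sat p) ⟩
      act (f u w) (h w)                     ≡⟨ sat u w uw ⟩
      h u                                   ∎

    stronglySatisfiable⇒imageIsCoboundary :
      Connected X → StronglySatisfiable X G A f → ImageIsCoboundary X G A f
    stronglySatisfiable⇒imageIsCoboundary (v₀ , path) (h , sat , onto) = γ , act-f≡act-δ₀γ
      where
      γ : V → Γ
      γ v = holonomy (path v v₀)

      h≡ : ∀ σ v → h σ v ≡ act (γ v) (h σ v₀)
      h≡ σ v = sym (satisfies⇒act-holonomy (sat σ) (path v v₀))

      act-f≡act-δ₀γ : ∀ u v → Edge u v → ∀ s → act (f u v) s ≡ act (γ u ∙ γ v ⁻¹) s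
      act-f≡act-δ₀γ u v uv s with onto v₀ (act (γ v ⁻¹) s)
      ... | σ , hσv₀≡ = begin
        act (f u v) s               ≡⟨ cong (act (f u v)) s≡hσv ⟩
        act (f u v) (h σ v)         ≡⟨ sat σ u v uv ⟩
        h σ u                       ≡⟨ h≡ σ u ⟩
        act (γ u) (h σ v₀)          ≡⟨ cong (act (γ u)) hσv₀≡ ⟩
        act (γ u) (act (γ v ⁻¹) s)  ≡⟨ act-∙ (γ u) (γ v ⁻¹) s ⟨
        act (γ u ∙ γ v ⁻¹) s        ∎
        where
        s≡hσv : s ≡ h σ v
        s≡hσv = begin
          s                           ≡⟨ act-inverseʳ A (γ v) s ⟨
          act (γ v) (act (γ v ⁻¹) s)  ≡⟨ cong (act (γ v)) hσv₀≡ ⟨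
          act (γ v) (h σ v₀)          ≡⟨ h≡ σ v ⟨
          h σ v                       ∎

    faithful⇒imageIsCoboundary⇒coboundary :
      Faithful A → ImageIsCoboundary X G A f → IsCoboundary X G f
    faithful⇒imageIsCoboundary⇒coboundary faithful (γ , φf≡φδ₀γ) =
      γ , λ u v uv → faithful _ _ (φf≡φδ₀γ u v uv)

mainTheorem5 : (X : SimplicialComplex) → Connected X →
    (G : Group 0ℓ 0ℓ) → IsFiniteGroup G →
    (S : Set) → (A : Action G S) →
    (f : SimplicialComplex.V X → SimplicialComplex.V X → Group.Carrier G) →
    IsCochain1 X G f →
    (IsCoboundary X G f → StronglySatisfiable X G A f)
    × (StronglySatisfiable X G A f →
        ImageIsCoboundary X G A f × (Faithful A → IsCoboundary X G f))
mainTheorem5 X connected G _ S A f _ =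
  coboundary⇒stronglySatisfiable X G A f ,
  λ stronglySat →
    let φf-coboundary = stronglySatisfiable⇒imageIsCoboundary X G A f connected stronglySat
    in φf-coboundary , λ faithful → faithful⇒imageIsCoboundary⇒coboundary X G A f faithful φf-coboundary
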